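{- For every positive rational number $r$, the complete tripartite graph $K_{1,3,3}$ is (isomorphic to) a subgraph of $G(\mathbb{Q}^5,\sqrt{r})$.
   Context: For $S \subseteq \mathbb{R}$, a positive integer $n$ and $d>0$, $G(S^n,d)$ denotes the graph with vertex set $S^n$ in which two vertices are adjacent if and only if their Euclidean distance is exactly $d$. Subgraphs need not be induced. -}

module Defs where

open import Level using (0ℓ)
open import Data.Nat using (ℕ)
open import Data.Fin using (Fin)
open import Data.Vec using (Vec; []; _∷_; lookup)
open import Data.Product using (Σ; ∃; _×_; _,_; proj₁)
open import Data.Rational using (ℚ; 0ℚ; _+_; _-_; _*_)
open import Relation.Binary.PropositionalEquality using (_≡_)
open import Relation.Nullary using (¬_)
open import Function.Definitions using (Injective)

record Graph : Set₁ where
  field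
    V   : Set
    Adj : V → V → Set
open Graph public

sqDist : ∀ {n} → Vec ℚ n → Vec ℚ n → ℚ
sqDist []       []       = 0ℚ
sqDist (x ∷ xs) (y ∷ ys) = (x - y) * (x - y) + sqDist xs ys

-- G(ℚ^n, √r): vertices ℚ^n, adjacent iff Euclidean distance is √r,
-- i.e. iff the squared distance equals r.
GQ : ℕ → ℚ → Graph
GQ n r = record { V = Vec ℚ n ; Adj = λ x y → sqDist x y ≡ r }

CompleteMultipartite : ∀ {k} → Vec ℕ k → Graph
CompleteMultipartite {k} sizes = record
  { V   = Σ (Fin k) (λ i → Fin (lookup sizes i))
  ; Adj = λ u v → ¬ (proj₁ u ≡ proj₁ v) }

K₁₃₃ : Graph
K₁₃₃ = CompleteMultipartite (1 ∷ 3 ∷ 3 ∷ [])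

-- H is isomorphic to a (not necessarily induced) subgraph of G:
-- an injective vertex map sending edges to edges.
_⊑_ : Graph → Graph → Set
H ⊑ G = ∃ λ (f : V H → V G) →
          Injective _≡_ _≡_ f × (∀ u v → Adj H u v → Adj G (f u) (f v))

-- Every positive rational is a sum of four rational squares, so r = 4N with N = |p|² for a
-- rational quaternion p.  Left multiplication by p scales squared distances by N (Euler's
-- four-square identity), so it suffices to realise K₁₃₃ by points (h, v) ∈ ℚ × ℚ⁴ with
-- (h - h′)² + N |v - v′|² = 4N along the edges, and then map (h, v) to (h, p·v).  Put the
-- part of size one at 0, the second part at 2e₁, 2e₂, 2e₃, and the third part at heights h
-- over the cube centre, (h, (1, 1, 1, σ)): these lie at the right distance from the first two
-- parts exactly when h² + Nσ² = N, and that conic has the rational points (σ, h) = (1, 0)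
-- and ((1 - 4N)/(1 + 4N), ±4N/(1 + 4N)).
--
-- The four-square theorem over ℚ needs no descent: sums of four rational squares are closed
-- under products and quotients, and for a prime p the ⌊p/2⌋ + 1 residues x² and the
-- ⌊p/2⌋ + 1 residues -1 - y² cannot all be distinct, which gives x² + y² + 1 = mp with
-- 0 < m < p; strong induction does the rest.

module Submission where

open import Defs

module SquaresModuloPrime where

  open import Data.Fin as Fin using (Fin; toℕ; fromℕ<; opposite; splitAt; _↑ˡ_; _↑ʳ_)
  open import Data.Fin.Properties as Fin
    using ( pigeonhole; toℕ-fromℕ<; toℕ-injective; toℕ≤pred[n]; opposite-prop; opposite-involutive
          ; splitAt⁻¹-↑ˡ; splitAt⁻¹-↑ʳ )
  open import Data.Nat
  open import Data.Nat.Properties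
  open import Data.Nat.DivMod using (_%_; _/_; m≡m%n+[m/n]*n; m%n<n)
  open import Data.Nat.Divisibility using (_∣_; divides; ∣m+n∣m⇒∣n; n∣m*n; >⇒∤)
  open import Data.Nat.Primality using (Prime; euclidsLemma; prime⇒nonZero; prime⇒nonTrivial)
  open import Data.Nat.Tactic.RingSolver using (solve-∀)
  open import Data.Product using (∃; ∃₂; _×_; _,_)
  open import Data.Sum using (inj₁; inj₂; [_,_]′)
  open import Function.Base using (_∘_)
  open import Function.Definitions using (Injective)
  open import Relation.Binary.Definitions using (tri<; tri≈; tri>)
  open import Relation.Binary.PropositionalEquality
  open import Relation.Nullary using (contradiction)

  images-intersect : ∀ {m n} (f g : Fin m → Fin n) → Injective _≡_ _≡_ f → Injective _≡_ _≡_ g →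
                     n < m + m → ∃₂ λ i j → f i ≡ g j
  images-intersect {m} f g f-injective g-injective n<m+m
    with pigeonhole n<m+m ([ f , g ]′ ∘ splitAt m)
  ... | a , b , a<b , eq with splitAt m a in split-a | splitAt m b in split-b
  ... | inj₁ i | inj₁ j = contradiction
        (trans (sym (splitAt⁻¹-↑ˡ split-a)) (trans (cong (_↑ˡ m) (f-injective eq)) (splitAt⁻¹-↑ˡ split-b)))
        (Fin.<⇒≢ a<b)
  ... | inj₁ i | inj₂ j = i , j , eq
  ... | inj₂ i | inj₁ j = j , i , sym eq
  ... | inj₂ i | inj₂ j = contradiction
        (trans (sym (splitAt⁻¹-↑ʳ split-a)) (trans (cong (m ↑ʳ_) (g-injective eq)) (splitAt⁻¹-↑ʳ split-b)))
        (Fin.<⇒≢ a<b)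

  [m+k]%n≡m%n⇒n∣k : ∀ m k n .{{_ : NonZero n}} → (m + k) % n ≡ m % n → n ∣ k
  [m+k]%n≡m%n⇒n∣k m k n eq = ∣m+n∣m⇒∣n (divides ((m + k) / n) shift) (n∣m*n (m / n))
    where
    open ≡-Reasoning
    shift : m / n * n + k ≡ (m + k) / n * n
    shift = +-cancelˡ-≡ (m % n) _ _ (begin
      m % n + (m / n * n + k)       ≡⟨ +-assoc (m % n) _ k ⟨
      m % n + m / n * n + k         ≡⟨ cong (_+ k) (m≡m%n+[m/n]*n m n) ⟨
      m + k                         ≡⟨ m≡m%n+[m/n]*n (m + k) n ⟩
      (m + k) % n + (m + k) / n * n ≡⟨ cong (_+ (m + k) / n * n) eq ⟩
      m % n + (m + k) / n * n       ∎)

  module _ {p : ℕ} (p-prime : Prime p) where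

    private
      instance
        p≢0 : NonZero p
        p≢0 = prime⇒nonZero p-prime

    squares-distinct : ∀ {x y} → x < y → y + x < p → x * x % p ≢ y * y % p
    squares-distinct {x} {y} x<y y+x<p x²≡y² with m≤n⇒∃[o]m+o≡n x<y
    ... | o , refl =
      [ >⇒∤ (≤-<-trans (≤-trans (s≤s (m≤n+m o x)) (m≤m+n y x)) y+x<p) , >⇒∤ y+x<p ]′
      (euclidsLemma (suc o) (y + x) p-prime p∣[y-x][y+x])
      where
      expand : ∀ x o → (suc x + o) * (suc x + o) ≡ x * x + suc o * ((suc x + o) + x)
      expand = solve-∀
      p∣[y-x][y+x] : p ∣ suc o * (y + x)
      p∣[y-x][y+x] = [m+k]%n≡m%n⇒n∣k (x * x) _ p (trans (cong (_% p) (sym (expand x o))) (sym x²≡y²))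

    K : ℕ
    K = ⌊ p /2⌋

    K+K≤p : K + K ≤ p
    K+K≤p = ≤-trans (+-monoʳ-≤ K (⌊n/2⌋≤⌈n/2⌉ p)) (≤-reflexive (⌊n/2⌋+⌈n/2⌉≡n p))

    p<[1+K]+[1+K] : p < suc K + suc K
    p<[1+K]+[1+K] = begin-strict
      p             ≡⟨ ⌊n/2⌋+⌈n/2⌉≡n p ⟨
      K + ⌈ p /2⌉   ≤⟨ +-monoʳ-≤ K (⌊n/2⌋-mono (n≤1+n (suc p))) ⟩
      K + suc K     <⟨ n<1+n (K + suc K) ⟩
      suc K + suc K ∎
      where open ≤-Reasoning

    1<p : 1 < p
    1<p = nonTrivial⇒n>1 p {{prime⇒nonTrivial p-prime}}

    K<p : K < p
    K<p = <-≤-trans (m<m+n K (⌊n/2⌋-mono 1<p)) K+K≤p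

    y+x<p : ∀ {x y} → x < y → y ≤ K → y + x < p
    y+x<p x<y y≤K = <-≤-trans (+-mono-≤-< y≤K (<-≤-trans x<y y≤K)) K+K≤p

    squares-injective : ∀ {x y} → x ≤ K → y ≤ K → x * x % p ≡ y * y % p → x ≡ y
    squares-injective {x} {y} x≤K y≤K x²≡y² with <-cmp x y
    ... | tri< x<y _ _ = contradiction x²≡y² (squares-distinct x<y (y+x<p x<y y≤K))
    ... | tri≈ _ x≡y _ = x≡y
    ... | tri> _ _ y<x = contradiction (sym x²≡y²) (squares-distinct y<x (y+x<p y<x x≤K))

    square : Fin (suc K) → Fin p
    square x = fromℕ< (m%n<n (toℕ x * toℕ x) p)

    toℕ-square : ∀ x → toℕ (square x) ≡ toℕ x * toℕ x % p
    toℕ-square x = toℕ-fromℕ< (m%n<n (toℕ x * toℕ x) p)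

    square-injective : Injective _≡_ _≡_ square
    square-injective {x} {y} eq = toℕ-injective (squares-injective (toℕ≤pred[n] x) (toℕ≤pred[n] y) (begin
      toℕ x * toℕ x % p ≡⟨ toℕ-square x ⟨
      toℕ (square x)    ≡⟨ cong toℕ eq ⟩
      toℕ (square y)    ≡⟨ toℕ-square y ⟩
      toℕ y * toℕ y % p ∎))
      where open ≡-Reasoning

    opposite-square-injective : Injective _≡_ _≡_ (opposite ∘ square)
    opposite-square-injective {x} {y} eq = square-injective (begin
      square x                       ≡⟨ opposite-involutive (square x) ⟨
      opposite (opposite (square x)) ≡⟨ cong opposite eq ⟩
      opposite (opposite (square y)) ≡⟨ opposite-involutive (square y) ⟩
      square y                       ∎)
      where open ≡-Reasoning

    complementary-squares : ∃₂ λ x y → x ≤ K × y ≤ K × x * x % p + suc (y * y % p) ≡ p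
    complementary-squares
      with images-intersect square (opposite ∘ square) square-injective opposite-square-injective
                            p<[1+K]+[1+K]
    ... | i , j , eq = toℕ i , toℕ j , toℕ≤pred[n] i , toℕ≤pred[n] j , (begin
      toℕ i * toℕ i % p + suc (toℕ j * toℕ j % p)           ≡⟨ cong (_+ suc (toℕ j * toℕ j % p)) i²≡-1-j² ⟩
      p ∸ suc (toℕ j * toℕ j % p) + suc (toℕ j * toℕ j % p) ≡⟨ m∸n+n≡m (m%n<n (toℕ j * toℕ j) p) ⟩
      p                                                     ∎)
      where
      open ≡-Reasoning
      i²≡-1-j² : toℕ i * toℕ i % p ≡ p ∸ suc (toℕ j * toℕ j % p)
      i²≡-1-j² = begin
        toℕ i * toℕ i % p           ≡⟨ toℕ-square i ⟨
        toℕ (square i)              ≡⟨ cong toℕ eq ⟩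
        toℕ (opposite (square j))   ≡⟨ opposite-prop (square j) ⟩
        p ∸ suc (toℕ (square j))    ≡⟨ cong (λ r → p ∸ suc r) (toℕ-square j) ⟩
        p ∸ suc (toℕ j * toℕ j % p) ∎

    x²+y²+1≡[1+m]p : ∃₂ λ x y → ∃ λ m → x * x + y * y + 1 ≡ suc m * p × suc m < p
    x²+y²+1≡[1+m]p with complementary-squares
    ... | x , y , x≤K , y≤K , residues = x , y , x * x / p + y * y / p , equation , bound
      where
      regroup : ∀ a b c d p → (a + b * p) + (c + d * p) + 1 ≡ (a + suc c) + (b + d) * p
      regroup = solve-∀
      equation : x * x + y * y + 1 ≡ suc (x * x / p + y * y / p) * p
      equation = begin
        x * x + y * y + 1
          ≡⟨ cong₂ (λ a b → a + b + 1) (m≡m%n+[m/n]*n (x * x) p) (m≡m%n+[m/n]*n (y * y) p) ⟩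
        (x * x % p + x * x / p * p) + (y * y % p + y * y / p * p) + 1
          ≡⟨ regroup (x * x % p) (x * x / p) (y * y % p) (y * y / p) p ⟩
        (x * x % p + suc (y * y % p)) + (x * x / p + y * y / p) * p
          ≡⟨ cong (_+ (x * x / p + y * y / p) * p) residues ⟩
        suc (x * x / p + y * y / p) * p ∎
        where open ≡-Reasoning
      bound : suc (x * x / p + y * y / p) < p
      bound = <-≤-trans (*-cancelʳ-< p _ (suc K) (begin-strict
        suc (x * x / p + y * y / p) * p ≡⟨ equation ⟨
        x * x + y * y + 1               ≤⟨ +-monoˡ-≤ 1 (+-mono-≤ (*-mono-≤ x≤K x≤K) (*-mono-≤ y≤K y≤K)) ⟩
        K * K + K * K + 1               ≡⟨ cong (_+ 1) (*-distribˡ-+ K K K) ⟨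
        K * (K + K) + 1                 ≤⟨ +-monoˡ-≤ 1 (*-monoʳ-≤ K K+K≤p) ⟩
        K * p + 1                       <⟨ +-monoʳ-< (K * p) 1<p ⟩
        K * p + p                       ≡⟨ +-comm (K * p) p ⟩
        suc K * p                       ∎)) K<p
        where open ≤-Reasoning

open SquaresModuloPrime using (x²+y²+1≡[1+m]p)

open import Data.Rational using (ℚ; 0ℚ; _<_)
open import Data.Rational
  using (½; _+_; _-_; _*_; -_; 1/_; ↥_; ↧ₙ_; mkℚ; toℚᵘ; Positive; NonNegative; NonZero; ≢-nonZero; positive)
open import Data.Rational.Properties
  using ( +-*-commutativeRing; _≟_; toℚᵘ-injective; toℚᵘ-homo-+; toℚᵘ-homo-*
        ; +-identityʳ; *-identityˡ; *-identityʳ; *-assoc; *-zeroʳ; *-inverseˡ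
        ; <⇒≢; neg<pos; positive⁻¹; negative⁻¹; neg-pos
        ; pos⇒nonZero; pos⇒nonNeg; pos+pos⇒pos; pos*pos⇒pos; 1/pos⇒pos )
open import Data.Rational.Unnormalised as ℚᵘ using (mkℚᵘ; *≡*) renaming (_≃_ to _≃ᵘ_)
import Data.Rational.Unnormalised.Properties as ℚᵘ
import Data.Integer as ℤ
open import Data.Integer using (1ℤ) renaming (_+_ to _+ℤ_; _*_ to _*ℤ_)
import Data.Integer.Tactic.RingSolver as ℤ
open import Data.Nat as ℕ using (ℕ; zero; suc)
import Data.Nat.Properties as ℕ
open import Data.Nat.Divisibility using (divides; quotient-<)
open import Data.Nat.Induction using (<-rec)
open import Data.Nat.Primality using (Prime; prime?; ¬prime⇒composite; composite)
import Data.Nat.Literals as ℕ-literals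
import Data.Rational.Literals as ℚ-literals
open import Data.Fin as Fin using (Fin; zero; suc)
open import Data.Vec using (Vec; []; _∷_)
open import Data.Vec.Properties using (∷-injectiveˡ; ∷-injectiveʳ)
open import Data.Product using (∃; _,_; proj₁; proj₂)
open import Data.Unit.Base using (tt)
open import Agda.Builtin.FromNat using (Number; fromNat)
open import Algebra.Bundles using (CommutativeRing)
import Algebra.Properties.Semiring.Mult as Mult
open import Function.Base using (_∘_)
open import Function.Definitions using (Injective)
open import Level using (0ℓ)
open import Relation.Binary.PropositionalEquality
open import Relation.Nullary using (yes; no; contradiction)
open import Relation.Nullary.Decidable using (dec⇒maybe)
open import Tactic.RingSolver using (solve-∀)
open import Tactic.RingSolver.Core.AlmostCommutativeRing using (AlmostCommutativeRing; fromCommutativeRing)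

instance
  ℕ-number : Number ℕ
  ℕ-number = ℕ-literals.number

  ℚ-number : Number ℚ
  ℚ-number = ℚ-literals.number

ℚ-ring : AlmostCommutativeRing 0ℓ 0ℓ
ℚ-ring = fromCommutativeRing +-*-commutativeRing (λ x → dec⇒maybe (0ℚ ≟ x))

x*y≡0⇒y≡0 : ∀ x {y} .{{_ : NonZero x}} → x * y ≡ 0ℚ → y ≡ 0ℚ
x*y≡0⇒y≡0 x {y} xy≡0 = begin
  y                ≡⟨ *-identityˡ y ⟨
  1 * y            ≡⟨ cong (_* y) (*-inverseˡ x) ⟨
  (1/ x) * x * y   ≡⟨ *-assoc (1/ x) x y ⟩
  (1/ x) * (x * y) ≡⟨ cong ((1/ x) *_) xy≡0 ⟩
  (1/ x) * 0ℚ      ≡⟨ *-zeroʳ (1/ x) ⟩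
  0ℚ               ∎
  where open ≡-Reasoning

sqDist-sym : ∀ {n} (x y : Vec ℚ n) → sqDist x y ≡ sqDist y x
sqDist-sym []      []      = refl
sqDist-sym (a ∷ x) (b ∷ y) = cong₂ _+_ (square-sym a b) (sqDist-sym x y)
  where
  square-sym : ∀ a b → (a - b) * (a - b) ≡ (b - a) * (b - a)
  square-sym = solve-∀ ℚ-ring

sqDist-self : ∀ {n} (x : Vec ℚ n) → sqDist x x ≡ 0ℚ
sqDist-self []      = refl
sqDist-self (a ∷ x) = trans (cong ((a - a) * (a - a) +_) (sqDist-self x)) (square-self a)
  where
  square-self : ∀ a → (a - a) * (a - a) + 0ℚ ≡ 0ℚ
  square-self = solve-∀ ℚ-ring

sqDist≢0⇒≢ : ∀ {n} {x y : Vec ℚ n} → sqDist x y ≢ 0ℚ → x ≢ y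
sqDist≢0⇒≢ {x = x} d≢0 refl = d≢0 (sqDist-self x)

sqNorm : Vec ℚ 4 → ℚ
sqNorm (a ∷ b ∷ c ∷ d ∷ []) = a * a + b * b + c * c + d * d

_⊖_ : Vec ℚ 4 → Vec ℚ 4 → Vec ℚ 4
(a ∷ b ∷ c ∷ d ∷ []) ⊖ (e ∷ f ∷ g ∷ h ∷ []) = a - e ∷ b - f ∷ c - g ∷ d - h ∷ []

sqDist≡sqNorm-⊖ : ∀ u v → sqDist u v ≡ sqNorm (u ⊖ v)
sqDist≡sqNorm-⊖ (a ∷ b ∷ c ∷ d ∷ []) (e ∷ f ∷ g ∷ h ∷ []) =
  reassociate ((a - e) * (a - e)) ((b - f) * (b - f)) ((c - g) * (c - g)) ((d - h) * (d - h))
  where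
  reassociate : ∀ x y z w → x + (y + (z + (w + 0ℚ))) ≡ x + y + z + w
  reassociate = solve-∀ ℚ-ring

dot : Vec ℚ 4 → Vec ℚ 4 → ℚ
dot (α ∷ β ∷ γ ∷ δ ∷ []) (e ∷ f ∷ g ∷ h ∷ []) = α * e + β * f + γ * g + δ * h

dot-⊖ : ∀ w u v → dot w (u ⊖ v) ≡ dot w u - dot w v
dot-⊖ (α ∷ β ∷ γ ∷ δ ∷ []) (e ∷ f ∷ g ∷ h ∷ []) (e′ ∷ f′ ∷ g′ ∷ h′ ∷ []) =
  linear α β γ δ e f g h e′ f′ g′ h′
  where
  linear : ∀ α β γ δ e f g h e′ f′ g′ h′ →
           α * (e - e′) + β * (f - f′) + γ * (g - g′) + δ * (h - h′) ≡
           (α * e + β * f + γ * g + δ * h) - (α * e′ + β * f′ + γ * g′ + δ * h′)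
  linear = solve-∀ ℚ-ring

-- Vectors in Vec ℚ 4 are read as quaternions a + bi + cj + dk, and _·_ is their product.
_·_ : Vec ℚ 4 → Vec ℚ 4 → Vec ℚ 4
(a ∷ b ∷ c ∷ d ∷ []) · v =
  dot (a ∷ - b ∷ - c ∷ - d ∷ []) v ∷ dot (b ∷ a ∷ - d ∷ c ∷ []) v ∷
  dot (c ∷ d ∷ a ∷ - b ∷ []) v ∷ dot (d ∷ - c ∷ b ∷ a ∷ []) v ∷ []

·-⊖ : ∀ p u v → p · (u ⊖ v) ≡ (p · u) ⊖ (p · v)
·-⊖ (a ∷ b ∷ c ∷ d ∷ []) u@(_ ∷ _ ∷ _ ∷ _ ∷ []) v@(_ ∷ _ ∷ _ ∷ _ ∷ []) =
  cong₂ _∷_ (dot-⊖ (a ∷ - b ∷ - c ∷ - d ∷ []) u v)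
  (cong₂ _∷_ (dot-⊖ (b ∷ a ∷ - d ∷ c ∷ []) u v)
  (cong₂ _∷_ (dot-⊖ (c ∷ d ∷ a ∷ - b ∷ []) u v)
  (cong₂ _∷_ (dot-⊖ (d ∷ - c ∷ b ∷ a ∷ []) u v) refl)))

euler-four-square : ∀ a b c d e f g h →
  (a * e + - b * f + - c * g + - d * h) * (a * e + - b * f + - c * g + - d * h) +
  (b * e + a * f + - d * g + c * h) * (b * e + a * f + - d * g + c * h) +
  (c * e + d * f + a * g + - b * h) * (c * e + d * f + a * g + - b * h) +
  (d * e + - c * f + b * g + a * h) * (d * e + - c * f + b * g + a * h) ≡
  (a * a + b * b + c * c + d * d) * (e * e + f * f + g * g + h * h)
euler-four-square = solve-∀ ℚ-ring

sqNorm-· : ∀ p q → sqNorm (p · q) ≡ sqNorm p * sqNorm q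
sqNorm-· (a ∷ b ∷ c ∷ d ∷ []) (e ∷ f ∷ g ∷ h ∷ []) = euler-four-square a b c d e f g h

sqDist-· : ∀ p u v → sqDist (p · u) (p · v) ≡ sqNorm p * sqDist u v
sqDist-· p u v = begin
  sqDist (p · u) (p · v)     ≡⟨ sqDist≡sqNorm-⊖ (p · u) (p · v) ⟩
  sqNorm ((p · u) ⊖ (p · v)) ≡⟨ cong sqNorm (·-⊖ p u v) ⟨
  sqNorm (p · (u ⊖ v))       ≡⟨ sqNorm-· p (u ⊖ v) ⟩
  sqNorm p * sqNorm (u ⊖ v)  ≡⟨ cong (sqNorm p *_) (sqDist≡sqNorm-⊖ u v) ⟨
  sqNorm p * sqDist u v      ∎
  where open ≡-Reasoning

IsSumOfFourSquares : ℚ → Set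
IsSumOfFourSquares x = ∃ λ v → sqNorm v ≡ x

isSumOfFourSquares-* : ∀ {x y} → IsSumOfFourSquares x → IsSumOfFourSquares y →
                       IsSumOfFourSquares (x * y)
isSumOfFourSquares-* (u , refl) (v , refl) = u · v , sqNorm-· u v

isSumOfFourSquares-square : ∀ t → IsSumOfFourSquares (t * t)
isSumOfFourSquares-square t = t ∷ 0 ∷ 0 ∷ 0 ∷ [] , pad t
  where
  pad : ∀ t → t * t + 0 * 0 + 0 * 0 + 0 * 0 ≡ t * t
  pad = solve-∀ ℚ-ring

isSumOfFourSquares-÷ : ∀ {x y} → x ≢ 0ℚ → IsSumOfFourSquares x → IsSumOfFourSquares (x * y) →
                       IsSumOfFourSquares y
isSumOfFourSquares-÷ {x} {y} x≢0 sum-x sum-xy =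
  subst IsSumOfFourSquares t²·xy·x≡y
        (isSumOfFourSquares-* (isSumOfFourSquares-square t) (isSumOfFourSquares-* sum-xy sum-x))
  where
  instance
    x-nonZero : NonZero x
    x-nonZero = ≢-nonZero x≢0
  t : ℚ
  t = 1/ x
  regroup : ∀ t x y → t * t * (x * y * x) ≡ (t * x) * (t * x) * y
  regroup = solve-∀ ℚ-ring
  t²·xy·x≡y : t * t * (x * y * x) ≡ y
  t²·xy·x≡y = begin
    t * t * (x * y * x)   ≡⟨ regroup t x y ⟩
    (t * x) * (t * x) * y ≡⟨ cong (λ s → s * s * y) (*-inverseˡ x) ⟩
    1 * 1 * y             ≡⟨ *-identityˡ y ⟩
    y                     ∎
    where open ≡-Reasoning

open Mult (CommutativeRing.semiring +-*-commutativeRing) using (×-homo-+; ×1-homo-*) renaming (_×_ to _·ℕ_)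

fromℕ : ℕ → ℚ
fromℕ n = n ·ℕ 1

fromℕ-+ : ∀ m n → fromℕ (m ℕ.+ n) ≡ fromℕ m + fromℕ n
fromℕ-+ = ×-homo-+ 1

fromℕ-* : ∀ m n → fromℕ (m ℕ.* n) ≡ fromℕ m * fromℕ n
fromℕ-* = ×1-homo-*

toℚᵘ-fromℕ : ∀ n → toℚᵘ (fromℕ n) ≃ᵘ mkℚᵘ (ℤ.+ n) 0
toℚᵘ-fromℕ zero    = ℚᵘ.≃-refl
toℚᵘ-fromℕ (suc n) = begin
  toℚᵘ (1 + fromℕ n)         ≈⟨ toℚᵘ-homo-+ 1 (fromℕ n) ⟩
  toℚᵘ 1 ℚᵘ.+ toℚᵘ (fromℕ n) ≈⟨ ℚᵘ.+-congʳ (toℚᵘ 1) (toℚᵘ-fromℕ n) ⟩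
  toℚᵘ 1 ℚᵘ.+ mkℚᵘ (ℤ.+ n) 0 ≈⟨ *≡* (cross-multiplied (ℤ.+ n)) ⟩
  mkℚᵘ (ℤ.+ suc n) 0         ∎
  where
  open ℚᵘ.≃-Reasoning
  cross-multiplied : ∀ i → (1ℤ *ℤ 1ℤ +ℤ i *ℤ 1ℤ) *ℤ 1ℤ ≡ (1ℤ +ℤ i) *ℤ (1ℤ *ℤ 1ℤ)
  cross-multiplied = ℤ.solve-∀

fromℕ[1+n]≢0 : ∀ n → fromℕ (suc n) ≢ 0ℚ
fromℕ[1+n]≢0 n eq with ℚᵘ.≃-trans (ℚᵘ.≃-sym (toℚᵘ-fromℕ (suc n))) (ℚᵘ.≃-reflexive (cong toℚᵘ eq))
... | *≡* ()

fromℕ-↧*≡fromℕ-↥ : ∀ r .{{_ : NonNegative r}} → fromℕ (↧ₙ r) * r ≡ fromℕ ℤ.∣ ↥ r ∣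
fromℕ-↧*≡fromℕ-↥ r@(mkℚ (ℤ.+ n) d-1 _) = toℚᵘ-injective (begin
  toℚᵘ (fromℕ (suc d-1) * r)                   ≈⟨ toℚᵘ-homo-* (fromℕ (suc d-1)) r ⟩
  toℚᵘ (fromℕ (suc d-1)) ℚᵘ.* mkℚᵘ (ℤ.+ n) d-1 ≈⟨ ℚᵘ.*-congʳ (toℚᵘ-fromℕ (suc d-1)) ⟩
  mkℚᵘ (ℤ.+ suc d-1) 0 ℚᵘ.* mkℚᵘ (ℤ.+ n) d-1   ≈⟨ *≡* cross-multiplied ⟩
  mkℚᵘ (ℤ.+ n) 0                               ≈⟨ toℚᵘ-fromℕ n ⟨
  toℚᵘ (fromℕ n)                               ∎)
  where
  open ℚᵘ.≃-Reasoning
  swap : ∀ i j → i *ℤ j *ℤ 1ℤ ≡ j *ℤ i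
  swap = ℤ.solve-∀
  -- The denominator of the product is 1 * suc d-1, which reduces to suc (d-1 + 0).
  cross-multiplied : ℤ.+ suc d-1 *ℤ ℤ.+ n *ℤ 1ℤ ≡ ℤ.+ n *ℤ ℤ.+ suc (d-1 ℕ.+ 0)
  cross-multiplied =
    trans (swap (ℤ.+ suc d-1) (ℤ.+ n)) (cong (λ k → ℤ.+ n *ℤ ℤ.+ suc k) (sym (ℕ.+-identityʳ d-1)))

sqNorm-fromℕ : ∀ x y → sqNorm (fromℕ x ∷ fromℕ y ∷ 1 ∷ 0 ∷ []) ≡ fromℕ (x ℕ.* x ℕ.+ y ℕ.* y ℕ.+ 1)
sqNorm-fromℕ x y = begin
  fromℕ x * fromℕ x + fromℕ y * fromℕ y + 1 * 1 + 0 * 0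
    ≡⟨ +-identityʳ _ ⟩
  fromℕ x * fromℕ x + fromℕ y * fromℕ y + 1
    ≡⟨ cong₂ (λ a b → a + b + 1) (fromℕ-* x x) (fromℕ-* y y) ⟨
  fromℕ (x ℕ.* x) + fromℕ (y ℕ.* y) + 1
    ≡⟨ cong (_+ 1) (fromℕ-+ (x ℕ.* x) (y ℕ.* y)) ⟨
  fromℕ (x ℕ.* x ℕ.+ y ℕ.* y) + fromℕ 1
    ≡⟨ fromℕ-+ (x ℕ.* x ℕ.+ y ℕ.* y) 1 ⟨
  fromℕ (x ℕ.* x ℕ.+ y ℕ.* y ℕ.+ 1)
    ∎
  where open ≡-Reasoning

isSumOfFourSquares-prime : ∀ {p} → Prime p → (∀ {m} → m ℕ.< p → IsSumOfFourSquares (fromℕ m)) →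
                           IsSumOfFourSquares (fromℕ p)
isSumOfFourSquares-prime {p} p-prime smaller =
  let x , y , m , x²+y²+1≡[1+m]p , 1+m<p = x²+y²+1≡[1+m]p p-prime
  in  isSumOfFourSquares-÷ (fromℕ[1+n]≢0 m) (smaller 1+m<p)
        ( fromℕ x ∷ fromℕ y ∷ 1 ∷ 0 ∷ []
        , trans (sqNorm-fromℕ x y) (trans (cong fromℕ x²+y²+1≡[1+m]p) (fromℕ-* (suc m) p)) )

isSumOfFourSquares-fromℕ : ∀ n → IsSumOfFourSquares (fromℕ n)
isSumOfFourSquares-fromℕ = <-rec (IsSumOfFourSquares ∘ fromℕ) step
  where
  step : ∀ n → (∀ {m} → m ℕ.< n → IsSumOfFourSquares (fromℕ m)) → IsSumOfFourSquares (fromℕ n)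
  step 0 _ = 0 ∷ 0 ∷ 0 ∷ 0 ∷ [] , refl
  step 1 _ = 1 ∷ 0 ∷ 0 ∷ 0 ∷ [] , refl
  step n@(suc (suc _)) smaller with prime? n
  ... | yes n-prime = isSumOfFourSquares-prime n-prime smaller
  ... | no ¬prime with ¬prime⇒composite ¬prime
  ...   | composite {d} d<n d∣n@(divides q n≡q*d) =
    subst (IsSumOfFourSquares ∘ fromℕ) (sym n≡q*d)
      (subst IsSumOfFourSquares (sym (fromℕ-* q d))
        (isSumOfFourSquares-* (smaller (quotient-< d∣n)) (smaller d<n)))

isSumOfFourSquares-nonNeg : ∀ r .{{_ : NonNegative r}} → IsSumOfFourSquares r
isSumOfFourSquares-nonNeg r =
  isSumOfFourSquares-÷ (fromℕ[1+n]≢0 (ℚ.denominator-1 r)) (isSumOfFourSquares-fromℕ (↧ₙ r))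
    (subst IsSumOfFourSquares (sym (fromℕ-↧*≡fromℕ-↥ r)) (isSumOfFourSquares-fromℕ ℤ.∣ ↥ r ∣))

complete-multipartite-injective :
  ∀ {k} {sizes : Vec ℕ k} {A : Set} (f : V (CompleteMultipartite sizes) → A) →
  (∀ u v → Adj (CompleteMultipartite sizes) u v → f u ≢ f v) →
  (∀ i → Injective _≡_ _≡_ (λ x → f (i , x))) →
  Injective _≡_ _≡_ f
complete-multipartite-injective f adjacent-distinct part-injective {i , x} {j , y} eq with i Fin.≟ j
... | yes refl = cong (i ,_) (part-injective i eq)
... | no i≢j   = contradiction eq (adjacent-distinct (i , x) (j , y) i≢j)

module Embedding (p : Vec ℚ 4) .{{_ : Positive (sqNorm p)}} where

  N : ℚ
  N = sqNorm p

  point : ℚ → Vec ℚ 4 → Vec ℚ 5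
  point h v = h ∷ p · v

  sqDist-point : ∀ h k u v → sqDist (point h u) (point k v) ≡ (h - k) * (h - k) + N * sqDist u v
  sqDist-point h k u v = cong ((h - k) * (h - k) +_) (sqDist-· p u v)

  ·-≡⇒sqDist≡0 : ∀ {u v} → p · u ≡ p · v → sqDist u v ≡ 0ℚ
  ·-≡⇒sqDist≡0 {u} {v} eq = x*y≡0⇒y≡0 N {{pos⇒nonZero N}} (begin
    N * sqDist u v         ≡⟨ sqDist-· p u v ⟨
    sqDist (p · u) (p · v) ≡⟨ cong (sqDist (p · u)) eq ⟨
    sqDist (p · u) (p · u) ≡⟨ sqDist-self (p · u) ⟩
    0ℚ                     ∎)
    where open ≡-Reasoning

  base : Fin 4 → Vec ℚ 4
  base zero                   = 0 ∷ 0 ∷ 0 ∷ 0 ∷ []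
  base (suc zero)             = 2 ∷ 0 ∷ 0 ∷ 0 ∷ []
  base (suc (suc zero))       = 0 ∷ 2 ∷ 0 ∷ 0 ∷ []
  base (suc (suc (suc zero))) = 0 ∷ 0 ∷ 2 ∷ 0 ∷ []

  apex : ℚ → Vec ℚ 4
  apex σ = 1 ∷ 1 ∷ 1 ∷ σ ∷ []

  sqDist-origin-corner : ∀ i → sqDist (base zero) (base (suc i)) ≡ 4
  sqDist-origin-corner zero             = refl
  sqDist-origin-corner (suc zero)       = refl
  sqDist-origin-corner (suc (suc zero)) = refl

  corner-injective : ∀ {i j} → sqDist (base (suc i)) (base (suc j)) ≡ 0ℚ → i ≡ j
  corner-injective {zero}           {zero}           _ = refl
  corner-injective {zero}           {suc zero}       ()
  corner-injective {zero}           {suc (suc zero)} ()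
  corner-injective {suc zero}       {zero}           ()
  corner-injective {suc zero}       {suc zero}       _ = refl
  corner-injective {suc zero}       {suc (suc zero)} ()
  corner-injective {suc (suc zero)} {zero}           ()
  corner-injective {suc (suc zero)} {suc zero}       ()
  corner-injective {suc (suc zero)} {suc (suc zero)} _ = refl

  -- (0 - 1)² and (2 - 1)² both evaluate to 1, so all four cases have the same normal form.
  sqDist-base-apex : ∀ b σ → sqDist (base b) (apex σ) ≡ 3 + σ * σ
  sqDist-base-apex zero                   = three-plus-square
    where
    three-plus-square : ∀ σ → 1 + (1 + (1 + ((0 - σ) * (0 - σ) + 0))) ≡ 3 + σ * σ
    three-plus-square = solve-∀ ℚ-ring
  sqDist-base-apex (suc zero)             = sqDist-base-apex zero
  sqDist-base-apex (suc (suc zero))       = sqDist-base-apex zero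
  sqDist-base-apex (suc (suc (suc zero))) = sqDist-base-apex zero

  OnCircle : ℚ → ℚ → Set
  OnCircle σ h = h * h + N * (σ * σ) ≡ N

  origin-to-corner : ∀ i → sqDist (point 0 (base zero)) (point 0 (base (suc i))) ≡ 4 * N
  origin-to-corner i = begin
    sqDist (point 0 (base zero)) (point 0 (base (suc i)))
      ≡⟨ sqDist-point 0 0 (base zero) (base (suc i)) ⟩
    (0 - 0) * (0 - 0) + N * sqDist (base zero) (base (suc i))
      ≡⟨ cong (λ d → (0 - 0) * (0 - 0) + N * d) (sqDist-origin-corner i) ⟩
    (0 - 0) * (0 - 0) + N * 4
      ≡⟨ rearrange N ⟩
    4 * N
      ∎
    where
    open ≡-Reasoning
    rearrange : ∀ N → (0 - 0) * (0 - 0) + N * 4 ≡ 4 * N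
    rearrange = solve-∀ ℚ-ring

  sqDist-base-apex-point : ∀ b σ h → OnCircle σ h → sqDist (point 0 (base b)) (point h (apex σ)) ≡ 4 * N
  sqDist-base-apex-point b σ h on-circle = begin
    sqDist (point 0 (base b)) (point h (apex σ))     ≡⟨ sqDist-point 0 h (base b) (apex σ) ⟩
    (0 - h) * (0 - h) + N * sqDist (base b) (apex σ) ≡⟨ cong (λ d → (0 - h) * (0 - h) + N * d)
                                                             (sqDist-base-apex b σ) ⟩
    (0 - h) * (0 - h) + N * (3 + σ * σ)              ≡⟨ regroup N σ h ⟩
    3 * N + (h * h + N * (σ * σ))                    ≡⟨ cong (3 * N +_) on-circle ⟩
    3 * N + N                                        ≡⟨ add N ⟩
    4 * N                                            ∎
    where
    open ≡-Reasoning
    regroup : ∀ N σ h → (0 - h) * (0 - h) + N * (3 + σ * σ) ≡ 3 * N + (h * h + N * (σ * σ))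
    regroup = solve-∀ ℚ-ring
    add : ∀ N → 3 * N + N ≡ 4 * N
    add = solve-∀ ℚ-ring

  4N>0 : Positive (4 * N)
  4N>0 = pos*pos⇒pos 4 {{_}} N

  1+4N>0 : Positive (1 + 4 * N)
  1+4N>0 = pos+pos⇒pos 1 {{_}} (4 * N) {{4N>0}}

  m : ℚ
  m = (1/ (1 + 4 * N)) {{pos⇒nonZero (1 + 4 * N) {{1+4N>0}}}}

  m*[1+4N]≡1 : m * (1 + 4 * N) ≡ 1
  m*[1+4N]≡1 = *-inverseˡ (1 + 4 * N) {{pos⇒nonZero (1 + 4 * N) {{1+4N>0}}}}

  k : ℚ
  k = 4 * N * m

  k>0 : Positive k
  k>0 = pos*pos⇒pos (4 * N) {{4N>0}} m {{1/pos⇒pos (1 + 4 * N) {{1+4N>0}}}}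

  slope : Fin 3 → ℚ
  slope zero    = 1
  slope (suc _) = (1 - 4 * N) * m

  height : Fin 3 → ℚ
  height zero             = 0
  height (suc zero)       = k
  height (suc (suc zero)) = - k

  on-circle : ∀ j → OnCircle (slope j) (height j)
  on-circle zero = unit N
    where
    unit : ∀ N → 0 * 0 + N * (1 * 1) ≡ N
    unit = solve-∀ ℚ-ring
  on-circle (suc zero) = begin
    k * k + N * (((1 - 4 * N) * m) * ((1 - 4 * N) * m)) ≡⟨ complete-square N m ⟩
    N * ((m * (1 + 4 * N)) * (m * (1 + 4 * N)))        ≡⟨ cong (λ x → N * (x * x)) m*[1+4N]≡1 ⟩
    N * (1 * 1)                                        ≡⟨ *-identityʳ N ⟩
    N                                                  ∎
    where
    open ≡-Reasoning
    complete-square : ∀ N m → (4 * N * m) * (4 * N * m) + N * (((1 - 4 * N) * m) * ((1 - 4 * N) * m)) ≡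
                              N * ((m * (1 + 4 * N)) * (m * (1 + 4 * N)))
    complete-square = solve-∀ ℚ-ring
  on-circle (suc (suc zero)) =
    trans (cong (_+ N * (slope (suc zero) * slope (suc zero))) (neg-square k)) (on-circle (suc zero))
    where
    neg-square : ∀ x → (- x) * (- x) ≡ x * x
    neg-square = solve-∀ ℚ-ring

  0<k : 0ℚ < k
  0<k = positive⁻¹ k {{k>0}}

  -k<0 : - k < 0ℚ
  -k<0 = negative⁻¹ (- k) {{neg-pos {k} k>0}}

  -k<k : - k < k
  -k<k = neg<pos (- k) k {{neg-pos {k} k>0}} {{k>0}}

  height-injective : Injective _≡_ _≡_ height
  height-injective {zero}           {zero}           _ = refl
  height-injective {zero}           {suc zero}       e = contradiction e (<⇒≢ 0<k)
  height-injective {zero}           {suc (suc zero)} e = contradiction (sym e) (<⇒≢ -k<0)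
  height-injective {suc zero}       {zero}           e = contradiction (sym e) (<⇒≢ 0<k)
  height-injective {suc zero}       {suc zero}       _ = refl
  height-injective {suc zero}       {suc (suc zero)} e = contradiction (sym e) (<⇒≢ -k<k)
  height-injective {suc (suc zero)} {zero}           e = contradiction e (<⇒≢ -k<0)
  height-injective {suc (suc zero)} {suc zero}       e = contradiction e (<⇒≢ -k<k)
  height-injective {suc (suc zero)} {suc (suc zero)} _ = refl

  embed : V K₁₃₃ → Vec ℚ 5
  embed (zero , _)           = point 0 (base zero)
  embed (suc zero , i)       = point 0 (base (suc i))
  embed (suc (suc zero) , j) = point (height j) (apex (slope j))

  base-to-apex : ∀ b j → sqDist (point 0 (base b)) (point (height j) (apex (slope j))) ≡ 4 * N
  base-to-apex b j = sqDist-base-apex-point b (slope j) (height j) (on-circle j)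

  reversed : ∀ u v → sqDist (embed u) (embed v) ≡ 4 * N → sqDist (embed v) (embed u) ≡ 4 * N
  reversed u v = trans (sqDist-sym (embed v) (embed u))

  embed-adjacent : ∀ u v → Adj K₁₃₃ u v → sqDist (embed u) (embed v) ≡ 4 * N
  embed-adjacent (zero , _)             (zero , _)           parts≢ = contradiction refl parts≢
  embed-adjacent (zero , _)             (suc zero , i)       _      = origin-to-corner i
  embed-adjacent (zero , _)             (suc (suc zero) , j) _      = base-to-apex zero j
  embed-adjacent u@(suc zero , i)       v@(zero , _)         _      = reversed v u (origin-to-corner i)
  embed-adjacent (suc zero , _)         (suc zero , _)       parts≢ = contradiction refl parts≢
  embed-adjacent (suc zero , i)         (suc (suc zero) , j) _      = base-to-apex (suc i) j
  embed-adjacent u@(suc (suc zero) , j) v@(zero , _)         _      = reversed v u (base-to-apex zero j)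
  embed-adjacent u@(suc (suc zero) , j) v@(suc zero , i)     _      = reversed v u (base-to-apex (suc i) j)
  embed-adjacent (suc (suc zero) , _)   (suc (suc zero) , _) parts≢ = contradiction refl parts≢

  embed-injective : Injective _≡_ _≡_ embed
  embed-injective =
    complete-multipartite-injective {sizes = 1 ∷ 3 ∷ 3 ∷ []} embed adjacent-distinct part-injective
    where
    4N≢0 : 4 * N ≢ 0ℚ
    4N≢0 = ≢-sym (<⇒≢ (positive⁻¹ (4 * N) {{4N>0}}))

    adjacent-distinct : ∀ u v → Adj K₁₃₃ u v → embed u ≢ embed v
    adjacent-distinct u v parts≢ = sqDist≢0⇒≢ (4N≢0 ∘ trans (sym (embed-adjacent u v parts≢)))

    part-injective : ∀ i → Injective _≡_ _≡_ (λ x → embed (i , x))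
    part-injective zero             {zero} {zero} _ = refl
    part-injective (suc zero)       eq = corner-injective (·-≡⇒sqDist≡0 (∷-injectiveʳ eq))
    part-injective (suc (suc zero)) eq = height-injective (∷-injectiveˡ eq)

  K₁₃₃⊑GQ5[4N] : K₁₃₃ ⊑ GQ 5 (4 * N)
  K₁₃₃⊑GQ5[4N] = embed , embed-injective , embed-adjacent

theorem3p9 : (r : ℚ) → 0ℚ < r → K₁₃₃ ⊑ GQ 5 r
theorem3p9 r 0<r = subst (K₁₃₃ ⊑_ ∘ GQ 5) 4N≡r (Embedding.K₁₃₃⊑GQ5[4N] p {{N>0}})
  where
  r/4>0 : Positive (½ * ½ * r)
  r/4>0 = pos*pos⇒pos (½ * ½) {{_}} r {{positive 0<r}}
  r/4 : IsSumOfFourSquares (½ * ½ * r)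
  r/4 = isSumOfFourSquares-nonNeg (½ * ½ * r) {{pos⇒nonNeg (½ * ½ * r) {{r/4>0}}}}
  p : Vec ℚ 4
  p = proj₁ r/4
  N>0 : Positive (sqNorm p)
  N>0 = subst Positive (sym (proj₂ r/4)) r/4>0
  quarter : ∀ r → 4 * (½ * ½ * r) ≡ r
  quarter = solve-∀ ℚ-ring
  4N≡r : 4 * sqNorm p ≡ r
  4N≡r = trans (cong (4 *_) (proj₂ r/4)) (quarter r)
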